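{- For each integer $n\geq 1$, let $a_n$ be the smallest integer $k\geq 1$ such that $s_k(n)$ is prime, if the sequence $(s_k(n))_{k\geq 0}$ contains a prime, and let $a_n=-1$ otherwise. Then: (1) if $n=\mathcal{T}_2(j)$ for some integer $j\geq 3$, then $a_n=-1$; (2) if $n=\mathcal{T}_p(j)$ for some integer $j\geq 3$ and some odd prime $p$, then either $s_{(p-1)/2}(n)$ is not prime and $a_n=-1$, or $s_{(p-1)/2}(n)$ is the only prime in the sequence $(s_k(n))_{k\geq 0}$ and $a_n=(p-1)/2$.
   Context: For an integer $n$, the sequence $(s_k(n))_{k\in\mathbb{Z}}$ is defined by $s_0(n)=1$, $s_1(n)=n+1$ and $s_{k+2}(n)=n\,s_{k+1}(n)-s_k(n)$ for all $k\in\mathbb{Z}$. The dilated Chebyshev polynomials of the first kind $\mathcal{T}_k$ ($k\in\mathbb{Z}$) are the polynomials with $\mathcal{T}_k(2\cos\theta)=2\cos(k\theta)$; equivalently $\mathcal{T}_0(x)=2$, $\mathcal{T}_1(x)=x$, $\mathcal{T}_{k+2}(x)=x\,\mathcal{T}_{k+1}(x)-\mathcal{T}_k(x)$. In particular $\mathcal{T}_2(j)=j^2-2$. -}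

module Defs where

open import Data.Nat as ℕ using (ℕ; zero; suc)
open import Data.Nat.Primality using (Prime)
open import Data.Integer using (ℤ; +_; -[1+_]; _+_; _-_; _*_; _≤_)
open import Data.Product using (Σ; _×_; ∃)
open import Data.Sum using (_⊎_)
open import Relation.Binary.PropositionalEquality using (_≡_)
open import Relation.Nullary using (¬_)

s : ℕ → ℤ → ℤ
s zero n = + 1
s (suc zero) n = n + + 1
s (suc (suc k)) n = n * s (suc k) n - s k n

𝒯 : ℕ → ℤ → ℤ
𝒯 zero x = + 2
𝒯 (suc zero) x = x
𝒯 (suc (suc k)) x = x * 𝒯 (suc k) x - 𝒯 k x

IsPrimeℤ : ℤ → Set
IsPrimeℤ x = Σ ℕ (λ q → (x ≡ + q) × Prime q)

HasA : ℤ → ℤ → Set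
HasA n a =
  ((a ≡ -[1+ 0 ]) × (∀ (k : ℕ) → ¬ IsPrimeℤ (s k n)))
  ⊎ Σ ℕ (λ m → (1 ℕ.≤ m) × (a ≡ + m) × IsPrimeℤ (s m n)
                 × (∀ (k : ℕ) → 1 ℕ.≤ k → k ℕ.< m → ¬ IsPrimeℤ (s k n)))

-- Write n = y² + y⁻². Then s_k(n) = (y^(2k+1) − y^−(2k+1)) / (y − y⁻¹), so s behaves like a
-- divisibility sequence indexed by the odd numbers 2k+1: s_(x+2y+1) = s_x + s_y 𝒯_(x+y+1), and
-- s_(ip+h)(N) = s_h(N) s_i(𝒯_p N) for p = 2h+1.
-- For n = 𝒯₂(j) one has s_k(n) = s_k(j) r_k(j) with both factors ≥ 2 once k ≥ 1.
-- For n = 𝒯_p(j) with p = 2H+1 prime and k ≥ 1: if p ∣ 2k+1 then k = ip + H and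
-- s_k(n) = s_H(n) s_i(𝒯_p n), a proper factorisation unless k = H; if p ∤ 2k+1 then
-- s_H(j) s_k(n) = s_(kp+H)(j) = s_k(j) s_H(𝒯_(2k+1) j), where s_k(j) and s_H(j) are coprime because
-- 2k+1 and 2H+1 are, so s_k(j) is a proper divisor of s_k(n).

module Submission where

open import Defs
open import Data.Nat as ℕ using (ℕ; zero; suc; _∸_; _/_; z≤n; s≤s)
import Data.Nat.Properties as ℕ
open import Data.Nat.Divisibility as ℕ using (divides; _∣?_)
open import Data.Nat.Coprimality as ℕ using (coprime-Bézout)
open import Data.Nat.GCD using (module Bézout)
open import Data.Nat.DivMod using (m*n/n≡m)
open import Data.Nat.Primality
  using (Prime; prime?; prime⇒irreducible; prime⇒¬composite; composite; ¬prime[1])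
open import Data.Integer
  using (ℤ; +_; -[1+_]; _+_; _-_; _*_; -_; _≤_; _<_; +≤+)
open import Data.Integer.Properties
  using (≤-refl; ≤-trans; ≤-reflexive; <⇒≤; +-monoˡ-≤; +-monoʳ-≤; +-mono-≤; i≤i+j; i≤j⇒0≤j-i;
         suc[i]≤j⇒i<j; i<j⇒suc[i]≤j; drop‿+<+; +-comm; +-identityʳ; *-comm; *-identityʳ;
         pos-*; +-injective; module ≤-Reasoning)
open import Data.Integer.Base using (nonNegative)
open import Data.Integer.Divisibility.Signed as Signed using (∣ᵤ⇒∣; ∣⇒∣ᵤ)
open import Data.Integer.Coprimality using (Coprime; coprime-divisor)
import Data.Integer.Divisibility as Unsigned
open import Data.Integer.Tactic.RingSolver using (solve-∀)
import Data.Nat.Tactic.RingSolver as ℕ-Solver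
open import Data.Product using (∃; ∃₂; _×_; _,_; proj₁; proj₂)
open import Data.Sum using (_⊎_; inj₁; inj₂)
open import Data.Empty using (⊥-elim)
open import Relation.Nullary using (¬_; Dec; yes; no)
import Relation.Nullary.Decidable as Dec
open import Relation.Binary.PropositionalEquality
  using (_≡_; _≢_; refl; sym; trans; cong; cong₂; subst; module ≡-Reasoning)

a+b≡c⇒a≡c-b : ∀ {a b c} → a + b ≡ c → a ≡ c - b
a+b≡c⇒a≡c-b {a} {b} refl = sym (cancel a b)
  where
  cancel : ∀ a b → (a + b) - b ≡ a
  cancel = solve-∀

a+[b-a]≡b : ∀ a b → a + (b - a) ≡ b
a+[b-a]≡b = solve-∀

Recurrence : ℤ → (ℕ → ℤ) → Set
Recurrence N x = ∀ k → x (suc (suc k)) ≡ N * x (suc k) - x k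

s-recurrence : ∀ N → Recurrence N (λ k → s k N)
s-recurrence N k = refl

𝒯-recurrence : ∀ x → Recurrence x (λ k → 𝒯 k x)
𝒯-recurrence x k = refl

recurrence-unique : ∀ {N f g} → Recurrence N f → Recurrence N g →
                    f 0 ≡ g 0 → f 1 ≡ g 1 → ∀ k → f k ≡ g k
recurrence-unique {N} {f} {g} rf rg f₀≡g₀ f₁≡g₁ k = proj₁ (agree k)
  where
  open ≡-Reasoning
  agree : ∀ k → f k ≡ g k × f (suc k) ≡ g (suc k)
  agree zero    = f₀≡g₀ , f₁≡g₁
  agree (suc k) with agree k
  ... | fk≡gk , fk+1≡gk+1 = fk+1≡gk+1 , (begin
    f (suc (suc k))        ≡⟨ rf k ⟩
    N * f (suc k) - f k    ≡⟨ cong₂ (λ u v → N * u - v) fk+1≡gk+1 fk≡gk ⟩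
    N * g (suc k) - g k    ≡⟨ sym (rg k) ⟩
    g (suc (suc k))        ∎)

recurrence-scale : ∀ {N x} c → Recurrence N x → Recurrence N (λ k → c * x k)
recurrence-scale {N} {x} c rx k = trans (cong (c *_) (rx k)) (distrib c N (x (suc k)) (x k))
  where
  distrib : ∀ c N a b → c * (N * a - b) ≡ N * (c * a) - c * b
  distrib = solve-∀

recurrence-neg : ∀ {N x} → Recurrence N x → Recurrence N (λ k → - x k)
recurrence-neg {N} {x} rx k = trans (cong -_ (rx k)) (distrib N (x (suc k)) (x k))
  where
  distrib : ∀ N a b → - (N * a - b) ≡ N * (- a) - (- b)
  distrib = solve-∀

recurrence-shift : ∀ {N x} → Recurrence N x →
                   ∀ a k → x (k ℕ.+ (a ℕ.+ a)) + x k ≡ 𝒯 a N * x (k ℕ.+ a)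
recurrence-shift {N} {x} rx zero k = begin
  x (k ℕ.+ 0) + x k  ≡⟨ cong (λ i → x i + x k) (ℕ.+-identityʳ k) ⟩
  x k + x k          ≡⟨ double (x k) ⟩
  + 2 * x k          ≡⟨ cong (λ i → + 2 * x i) (sym (ℕ.+-identityʳ k)) ⟩
  + 2 * x (k ℕ.+ 0)  ∎
  where
  open ≡-Reasoning
  double : ∀ a → a + a ≡ + 2 * a
  double = solve-∀
recurrence-shift {N} {x} rx (suc zero) k = begin
  x (k ℕ.+ 2) + x k           ≡⟨ cong (λ i → x i + x k) (ℕ.+-comm k 2) ⟩
  x (suc (suc k)) + x k       ≡⟨ cong (_+ x k) (rx k) ⟩
  (N * x (suc k) - x k) + x k ≡⟨ cancel N (x (suc k)) (x k) ⟩
  N * x (suc k)               ≡⟨ cong (λ i → N * x i) (ℕ.+-comm 1 k) ⟩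
  N * x (k ℕ.+ 1)             ∎
  where
  open ≡-Reasoning
  cancel : ∀ N a b → (N * a - b) + b ≡ N * a
  cancel = solve-∀
recurrence-shift {N} {x} rx (suc (suc a)) k = begin
  x (k ℕ.+ (2+a ℕ.+ 2+a)) + x k
    ≡⟨ cong₂ _+_ (cong x (i₁+1≡ k a)) (sym (backwards k)) ⟩
  x (suc i₁) + (N * x (suc k) - x (suc (suc k)))
    ≡⟨ cong (_+ (N * x (suc k) - x (suc (suc k))))
            (trans (cong (λ i → x (suc i)) (i₁≡ k a)) (rx i₀)) ⟩
  (N * x (suc i₀) - x i₀) + (N * x (suc k) - x (suc (suc k)))
    ≡⟨ regroup N (x (suc i₀)) (x i₀) (x (suc k)) (x (suc (suc k))) ⟩
  N * (x (suc i₀) + x (suc k)) - (x i₀ + x (suc (suc k)))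
    ≡⟨ cong₂ (λ u v → N * u - v)
         (trans (cong (λ i → x i + x (suc k)) (sym (i₁≡ k a)))
                (recurrence-shift rx (suc a) (suc k)))
         (recurrence-shift rx a (suc (suc k))) ⟩
  N * (𝒯 (suc a) N * x (suc k ℕ.+ suc a)) - 𝒯 a N * x (suc (suc k) ℕ.+ a)
    ≡⟨ cong₂ (λ u v → N * (𝒯 (suc a) N * x u) - 𝒯 a N * x v) (w₁≡ k a) (w₀≡ k a) ⟩
  N * (𝒯 (suc a) N * x w) - 𝒯 a N * x w
    ≡⟨ factor N (𝒯 (suc a) N) (𝒯 a N) (x w) ⟩
  𝒯 (suc (suc a)) N * x w ∎
  where
  open ≡-Reasoning
  2+a = suc (suc a)
  i₀ = suc (suc k) ℕ.+ (a ℕ.+ a)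
  i₁ = suc k ℕ.+ (suc a ℕ.+ suc a)
  w = k ℕ.+ 2+a
  backwards : ∀ k → N * x (suc k) - x (suc (suc k)) ≡ x k
  backwards k = trans (cong (λ t → N * x (suc k) - t) (rx k)) (cancel N (x (suc k)) (x k))
    where
    cancel : ∀ N a b → N * a - (N * a - b) ≡ b
    cancel = solve-∀
  i₁≡ : ∀ k a → suc k ℕ.+ (suc a ℕ.+ suc a) ≡ suc (suc (suc k) ℕ.+ (a ℕ.+ a))
  i₁≡ = ℕ-Solver.solve-∀
  i₁+1≡ : ∀ k a → k ℕ.+ (suc (suc a) ℕ.+ suc (suc a)) ≡ suc (suc k ℕ.+ (suc a ℕ.+ suc a))
  i₁+1≡ = ℕ-Solver.solve-∀
  w₁≡ : ∀ k a → suc k ℕ.+ suc a ≡ k ℕ.+ suc (suc a)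
  w₁≡ = ℕ-Solver.solve-∀
  w₀≡ : ∀ k a → suc (suc k) ℕ.+ a ≡ k ℕ.+ suc (suc a)
  w₀≡ = ℕ-Solver.solve-∀
  regroup : ∀ N a b c d → (N * a - b) + (N * c - d) ≡ N * (a + c) - (b + d)
  regroup = solve-∀
  factor : ∀ N T₁ T₀ y → N * (T₁ * y) - T₀ * y ≡ (N * T₁ - T₀) * y
  factor = solve-∀

prepend : ℤ → (ℕ → ℤ) → ℕ → ℤ
prepend N x zero    = N * x 0 - x 1
prepend N x (suc k) = x k

prepend-recurrence : ∀ {N x} → Recurrence N x → Recurrence N (prepend N x)
prepend-recurrence {N} {x} rx zero    = cancel N (x 0) (x 1)
  where
  cancel : ∀ N a b → b ≡ N * a - (N * a - b)
  cancel = solve-∀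
prepend-recurrence {N} {x} rx (suc k) = rx k

-- prepend^ N h x is x shifted h places to the right and continued backwards by
-- the recurrence, i.e. prepend^ N h x i = x_{i-h}.
prepend^ : ℤ → ℕ → (ℕ → ℤ) → ℕ → ℤ
prepend^ N zero    x = x
prepend^ N (suc h) x = prepend N (prepend^ N h x)

prepend^-recurrence : ∀ {N x} h → Recurrence N x → Recurrence N (prepend^ N h x)
prepend^-recurrence             zero    rx = rx
prepend^-recurrence {N} {x} (suc h) rx =
  prepend-recurrence {N} {prepend^ N h x} (prepend^-recurrence h rx)

prepend^-+ : ∀ N h x i → prepend^ N h x (h ℕ.+ i) ≡ x i
prepend^-+ N zero    x i = refl
prepend^-+ N (suc h) x i = prepend^-+ N h x i

prepend^-head-recurrence : ∀ N x → Recurrence N (λ h → prepend^ N h x 0)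
prepend^-head-recurrence N x h = refl

s-prepend^ : ∀ N t → prepend^ N (suc t) (λ k → s k N) 0 ≡ - s t N
s-prepend^ N = recurrence-unique {N} {λ t → prepend^ N (suc t) (λ k → s k N) 0} {λ t → - s t N}
  (λ t → prepend^-head-recurrence N (λ k → s k N) (suc t))
  (recurrence-neg {N} {λ k → s k N} (s-recurrence N))
  (initial₀ N) (initial₁ N)
  where
  initial₀ : ∀ N → N * + 1 - (N + + 1) ≡ - + 1
  initial₀ = solve-∀
  initial₁ : ∀ N → N * (N * + 1 - (N + + 1)) - + 1 ≡ - (N + + 1)
  initial₁ = solve-∀

s-+-odd : ∀ N x y → s (x ℕ.+ suc (y ℕ.+ y)) N ≡ s x N + s y N * 𝒯 (suc (x ℕ.+ y)) N
s-+-odd N x y = begin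
  s (x ℕ.+ suc (y ℕ.+ y)) N        ≡⟨ sym (prepend^-+ N (suc x) S (x ℕ.+ suc (y ℕ.+ y))) ⟩
  σ (suc x ℕ.+ (x ℕ.+ suc (y ℕ.+ y))) ≡⟨ cong σ (index x y) ⟩
  σ (a ℕ.+ a)                      ≡⟨ a+b≡c⇒a≡c-b (recurrence-shift σ-recurrence a 0) ⟩
  𝒯 a N * σ a - σ 0
    ≡⟨ cong₂ (λ u v → 𝒯 a N * u - v) (prepend^-+ N (suc x) S y) (s-prepend^ N x) ⟩
  𝒯 a N * s y N - - s x N           ≡⟨ rearrange (𝒯 a N) (s y N) (s x N) ⟩
  s x N + s y N * 𝒯 a N             ∎
  where
  open ≡-Reasoning
  S : ℕ → ℤ
  S k = s k N
  σ : ℕ → ℤ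
  σ = prepend^ N (suc x) S
  σ-recurrence : Recurrence N σ
  σ-recurrence = prepend^-recurrence (suc x) (s-recurrence N)
  a = suc (x ℕ.+ y)
  index : ∀ x y → suc x ℕ.+ (x ℕ.+ suc (y ℕ.+ y)) ≡ suc (x ℕ.+ y) ℕ.+ suc (x ℕ.+ y)
  index = ℕ-Solver.solve-∀
  rearrange : ∀ T b c → T * b - - c ≡ c + b * T
  rearrange = solve-∀

recurrence-subsequence : ∀ {N x} → Recurrence N x →
                         ∀ p c → Recurrence (𝒯 p N) (λ i → x (i ℕ.* p ℕ.+ c))
recurrence-subsequence {N} {x} rx p c i = begin
  x (suc (suc i) ℕ.* p ℕ.+ c)            ≡⟨ cong x (index₂ i p c) ⟩
  x (k ℕ.+ (p ℕ.+ p))                    ≡⟨ a+b≡c⇒a≡c-b (recurrence-shift rx p k) ⟩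
  𝒯 p N * x (k ℕ.+ p) - x k              ≡⟨ cong (λ j → 𝒯 p N * x j - x k) (index₁ i p c) ⟩
  𝒯 p N * x (suc i ℕ.* p ℕ.+ c) - x k    ∎
  where
  open ≡-Reasoning
  k = i ℕ.* p ℕ.+ c
  index₂ : ∀ i p c → suc (suc i) ℕ.* p ℕ.+ c ≡ (i ℕ.* p ℕ.+ c) ℕ.+ (p ℕ.+ p)
  index₂ = ℕ-Solver.solve-∀
  index₁ : ∀ i p c → (i ℕ.* p ℕ.+ c) ℕ.+ p ≡ suc i ℕ.* p ℕ.+ c
  index₁ = ℕ-Solver.solve-∀

s-odd-factor : ∀ N h i →
               s (i ℕ.* suc (h ℕ.+ h) ℕ.+ h) N ≡ s h N * s i (𝒯 (suc (h ℕ.+ h)) N)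
s-odd-factor N h = recurrence-unique {T} {λ i → s (i ℕ.* p ℕ.+ h) N} {λ i → s h N * s i T}
  (recurrence-subsequence (s-recurrence N) p h)
  (recurrence-scale {T} {λ i → s i T} (s h N) (s-recurrence T))
  (sym (*-identityʳ (s h N)))
  (begin
    s (1 ℕ.* p ℕ.+ h) N     ≡⟨ cong (λ i → s i N) (index h) ⟩
    s (h ℕ.+ p) N           ≡⟨ s-+-odd N h h ⟩
    s h N + s h N * T       ≡⟨ factor (s h N) T ⟩
    s h N * (T + + 1)       ∎)
  where
  open ≡-Reasoning
  p = suc (h ℕ.+ h)
  T = 𝒯 p N
  index : ∀ h → 1 ℕ.* suc (h ℕ.+ h) ℕ.+ h ≡ h ℕ.+ suc (h ℕ.+ h)
  index = ℕ-Solver.solve-∀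
  factor : ∀ a T → a + a * T ≡ a * (T + + 1)
  factor = solve-∀

-- r k j = (-1)^k s_k(-j)
r : ℕ → ℤ → ℤ
r zero          j = + 1
r (suc zero)    j = j - + 1
r (suc (suc k)) j = j * r (suc k) j - r k j

s-r-defect : ℤ → ℕ → ℤ
s-r-defect j k = j * (s (suc k) j * r k j + s k j * r (suc k) j)
                 - + 2 * (s (suc k) j * r (suc k) j + s k j * r k j)

s-r-defect≡0 : ∀ j k → s-r-defect j k ≡ + 0
s-r-defect≡0 j zero    = base j
  where
  base : ∀ j → j * ((j + + 1) * + 1 + + 1 * (j - + 1)) - + 2 * ((j + + 1) * (j - + 1) + + 1 * + 1) ≡ + 0
  base = solve-∀
s-r-defect≡0 j (suc k) =
  trans (constant j (s k j) (s (suc k) j) (r k j) (r (suc k) j)) (s-r-defect≡0 j k)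
  where
  constant : ∀ j S₀ S₁ R₀ R₁ →
    j * ((j * S₁ - S₀) * R₁ + S₁ * (j * R₁ - R₀)) - + 2 * ((j * S₁ - S₀) * (j * R₁ - R₀) + S₁ * R₁) ≡
    j * (S₁ * R₀ + S₀ * R₁) - + 2 * (S₁ * R₁ + S₀ * R₀)
  constant = solve-∀

s-r-recurrence : ∀ j → Recurrence (𝒯 2 j) (λ k → s k j * r k j)
s-r-recurrence j k = begin
  s (suc (suc k)) j * r (suc (suc k)) j    ≡⟨ expand j (s k j) (s (suc k) j) (r k j) (r (suc k) j) ⟩
  X - s-r-defect j k                       ≡⟨ cong (λ t → X - t) (s-r-defect≡0 j k) ⟩
  X - + 0                                  ≡⟨ +-identityʳ X ⟩
  X                                        ∎
  where
  open ≡-Reasoning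
  X = 𝒯 2 j * (s (suc k) j * r (suc k) j) - s k j * r k j
  expand : ∀ j S₀ S₁ R₀ R₁ →
    (j * S₁ - S₀) * (j * R₁ - R₀) ≡
    ((j * j - + 2) * (S₁ * R₁) - S₀ * R₀) - (j * (S₁ * R₀ + S₀ * R₁) - + 2 * (S₁ * R₁ + S₀ * R₀))
  expand = solve-∀

s-𝒯₂ : ∀ j k → s k (𝒯 2 j) ≡ s k j * r k j
s-𝒯₂ j = recurrence-unique {𝒯 2 j} {λ k → s k (𝒯 2 j)} {λ k → s k j * r k j}
  (s-recurrence (𝒯 2 j)) (s-r-recurrence j) refl (initial j)
  where
  initial : ∀ j → (j * j - + 2) + + 1 ≡ (j + + 1) * (j - + 1)
  initial = solve-∀

Supersolution : ℤ → (ℕ → ℤ) → Set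
Supersolution N x = ∀ k → N * x (suc k) - x k ≤ x (suc (suc k))

recurrence⇒supersolution : ∀ {N x} → Recurrence N x → Supersolution N x
recurrence⇒supersolution rx k = ≤-reflexive (sym (rx k))

0≤* : ∀ {a b} → + 0 ≤ a → + 0 ≤ b → + 0 ≤ a * b
0≤* {+ m} {+ n} _ _ = subst (+ 0 ≤_) (pos-* m n) (+≤+ z≤n)

module _ {N : ℤ} {x : ℕ → ℤ} (2≤N : + 2 ≤ N) (sup : Supersolution N x)
         (0≤x₀ : + 0 ≤ x 0) (x₀≤x₁ : x 0 ≤ x 1) where

  private
    nonneg-and-supersolution-increment-≥ : ∀ k → + 0 ≤ x k × x 1 - x 0 ≤ x (suc k) - x k
    nonneg-and-supersolution-increment-≥ zero    = 0≤x₀ , ≤-refl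
    nonneg-and-supersolution-increment-≥ (suc k) with nonneg-and-supersolution-increment-≥ k
    ... | 0≤xₖ , d≤Δₖ = 0≤xₖ₊₁ , d≤Δₖ₊₁
      where
      open ≤-Reasoning
      0≤d : + 0 ≤ x 1 - x 0
      0≤d = i≤j⇒0≤j-i x₀≤x₁
      0≤xₖ₊₁ : + 0 ≤ x (suc k)
      0≤xₖ₊₁ = begin
        + 0                      ≤⟨ +-mono-≤ 0≤xₖ (≤-trans 0≤d d≤Δₖ) ⟩
        x k + (x (suc k) - x k)  ≡⟨ a+[b-a]≡b (x k) (x (suc k)) ⟩
        x (suc k)                ∎
      d≤Δₖ₊₁ : x 1 - x 0 ≤ x (suc (suc k)) - x (suc k)
      d≤Δₖ₊₁ = begin
        x 1 - x 0                                        ≤⟨ d≤Δₖ ⟩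
        x (suc k) - x k                                  ≤⟨ i≤i+j _ _ ⦃ nonNegative
                                                              (0≤* (i≤j⇒0≤j-i 2≤N) 0≤xₖ₊₁) ⦄ ⟩
        (x (suc k) - x k) + (N - + 2) * x (suc k)        ≡⟨ regroup N (x (suc k)) (x k) ⟩
        (N * x (suc k) - x k) - x (suc k)                ≤⟨ +-monoˡ-≤ (- x (suc k)) (sup k) ⟩
        x (suc (suc k)) - x (suc k)                      ∎
        where
        regroup : ∀ N a b → (a - b) + (N - + 2) * a ≡ (N * a - b) - a
        regroup = solve-∀

  supersolution-increment-≥ : ∀ k → x 1 - x 0 ≤ x (suc k) - x k
  supersolution-increment-≥ k = proj₂ (nonneg-and-supersolution-increment-≥ k)

  supersolution-mono : ∀ a k → x a ≤ x (a ℕ.+ k)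
  supersolution-mono a zero    = ≤-reflexive (cong x (sym (ℕ.+-identityʳ a)))
  supersolution-mono a (suc k) = begin
    x a                                       ≤⟨ supersolution-mono a k ⟩
    x (a ℕ.+ k)                               ≤⟨ i≤i+j _ _ ⦃ nonNegative (≤-trans (i≤j⇒0≤j-i x₀≤x₁)
                                                     (supersolution-increment-≥ (a ℕ.+ k))) ⦄ ⟩
    x (a ℕ.+ k) + (x (suc (a ℕ.+ k)) - x (a ℕ.+ k)) ≡⟨ a+[b-a]≡b (x (a ℕ.+ k)) (x (suc (a ℕ.+ k))) ⟩
    x (suc (a ℕ.+ k))                         ≡⟨ cong x (sym (ℕ.+-suc a k)) ⟩
    x (a ℕ.+ suc k)                           ∎
    where
    open ≤-Reasoning

2≤3 : + 2 ≤ + 3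
2≤3 = +≤+ (s≤s (s≤s z≤n))

module _ {N : ℤ} (2≤N : + 2 ≤ N) where

  private
    s-mono : ∀ a k → s a N ≤ s (a ℕ.+ k) N
    s-mono = supersolution-mono 2≤N (recurrence⇒supersolution {N} {λ k → s k N} (s-recurrence N))
                (+≤+ z≤n) (≤-trans (+≤+ (s≤s z≤n)) (+-monoˡ-≤ (+ 1) 2≤N))

  s-nonneg : ∀ k → + 0 ≤ s k N
  s-nonneg k = ≤-trans (+≤+ z≤n) (s-mono 0 k)

  s-suc-≥2 : ∀ k → + 2 ≤ s (suc k) N
  s-suc-≥2 k = ≤-trans (≤-trans 2≤3 (+-monoˡ-≤ (+ 1) 2≤N)) (s-mono 1 k)

  𝒯-≥2 : ∀ k → + 2 ≤ 𝒯 k N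
  𝒯-≥2 = supersolution-mono 2≤N (recurrence⇒supersolution {N} {λ k → 𝒯 k N} (𝒯-recurrence N))
                            (+≤+ z≤n) 2≤N 0

module _ {j : ℤ} (3≤j : + 3 ≤ j) where

  private
    2≤j : + 2 ≤ j
    2≤j = ≤-trans 2≤3 3≤j

  r-suc-≥2 : ∀ k → + 2 ≤ r (suc k) j
  r-suc-≥2 k = ≤-trans 2≤j-1
    (supersolution-mono 2≤j (recurrence⇒supersolution {j} {λ k → r k j} (λ _ → refl))
                        (+≤+ z≤n) (≤-trans (+≤+ (s≤s z≤n)) 2≤j-1) 1 k)
    where
    2≤j-1 : + 2 ≤ j - + 1
    2≤j-1 = +-monoˡ-≤ (- + 1) 3≤j

  𝒯-suc-suc-> : ∀ k → j < 𝒯 (suc (suc k)) j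
  𝒯-suc-suc-> k = suc[i]≤j⇒i<j (begin
    + 1 + j                  ≡⟨ +-comm (+ 1) j ⟩
    j + + 1                  ≤⟨ +-mono-≤ (supersolution-mono 2≤j sup (+≤+ z≤n) 2≤j 1 k) 1≤Δ ⟩
    T (suc k) + (T (suc (suc k)) - T (suc k)) ≡⟨ a+[b-a]≡b (T (suc k)) (T (suc (suc k))) ⟩
    T (suc (suc k))          ∎)
    where
    open ≤-Reasoning
    T : ℕ → ℤ
    T k = 𝒯 k j
    sup : Supersolution j T
    sup = recurrence⇒supersolution {j} {T} (𝒯-recurrence j)
    1≤Δ : + 1 ≤ T (suc (suc k)) - T (suc k)
    1≤Δ = ≤-trans (+-monoˡ-≤ (- + 2) 3≤j) (supersolution-increment-≥ 2≤j sup (+≤+ z≤n) 2≤j (suc k))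

s-<-argument : ∀ {j n} → + 2 ≤ j → j < n → ∀ k → s (suc k) j < s (suc k) n
s-<-argument {j} {n} 2≤j j<n k = suc[i]≤j⇒i<j (begin
  + 1 + s (suc k) j         ≡⟨ +-comm (+ 1) (s (suc k) j) ⟩
  s (suc k) j + + 1         ≤⟨ +-monoʳ-≤ (s (suc k) j)
                                 (≤-trans 1≤d₁ (supersolution-mono 2≤n sup (+≤+ z≤n) d₀≤d₁ 1 k)) ⟩
  s (suc k) j + d (suc k)   ≡⟨ a+[b-a]≡b (s (suc k) j) (s (suc k) n) ⟩
  s (suc k) n               ∎)
  where
  open ≤-Reasoning
  d : ℕ → ℤ
  d k = s k n - s k j
  2≤n : + 2 ≤ n
  2≤n = ≤-trans 2≤j (<⇒≤ j<n)
  1≤d₁ : + 1 ≤ d 1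
  1≤d₁ = begin
    + 1                           ≡⟨ shift-1 j ⟩
    ((+ 1 + j) + + 1) - (j + + 1) ≤⟨ +-monoˡ-≤ (- (j + + 1)) (+-monoˡ-≤ (+ 1) (i<j⇒suc[i]≤j j<n)) ⟩
    (n + + 1) - (j + + 1)         ∎
    where
    shift-1 : ∀ j → + 1 ≡ ((+ 1 + j) + + 1) - (j + + 1)
    shift-1 = solve-∀
  d₀≤d₁ : d 0 ≤ d 1
  d₀≤d₁ = ≤-trans (+≤+ z≤n) 1≤d₁
  sup : Supersolution n d
  sup k = begin
    n * d (suc k) - d k                                ≤⟨ i≤i+j _ _ ⦃ nonNegative
                                                            (0≤* (i≤j⇒0≤j-i (<⇒≤ j<n)) (s-nonneg 2≤j (suc k))) ⦄ ⟩
    (n * d (suc k) - d k) + (n - j) * s (suc k) j      ≡⟨ regroup n j (s (suc k) n) (s (suc k) j) (s k n) (s k j) ⟩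
    d (suc (suc k))                                    ∎
    where
    regroup : ∀ n j a b c e → (n * (a - b) - (c - e)) + (n - j) * b ≡ (n * a - c) - (j * b - e)
    regroup = solve-∀

¬IsPrimeℤ-1 : ¬ IsPrimeℤ (+ 1)
¬IsPrimeℤ-1 (q , 1≡q , pq) = ¬prime[1] (subst Prime (sym (+-injective 1≡q)) pq)

¬IsPrimeℤ-* : ∀ {a b} → + 2 ≤ a → + 2 ≤ b → ¬ IsPrimeℤ (a * b)
¬IsPrimeℤ-* {+ a} {+ b} (+≤+ (s≤s (s≤s _))) (+≤+ 1<b) (q , ab≡q , pq) =
  prime⇒¬composite pq (composite (subst (a ℕ.<_) ab≡q′ (ℕ.m<m*n a b 1<b))
                                 (subst (a ℕ.∣_) ab≡q′ (ℕ.m∣m*n b)))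
  where
  ab≡q′ : a ℕ.* b ≡ q
  ab≡q′ = +-injective (trans (pos-* a b) ab≡q)

¬IsPrimeℤ-proper-divisor : ∀ {d x} → + 2 ≤ d → d < x → d Unsigned.∣ x → ¬ IsPrimeℤ x
¬IsPrimeℤ-proper-divisor (+≤+ (s≤s (s≤s _))) d<x d∣x (q , refl , pq) =
  prime⇒¬composite pq (composite (drop‿+<+ d<x) d∣x)

isPrimeℤ? : ∀ x → Dec (IsPrimeℤ x)
isPrimeℤ? (+ q)    = Dec.map′ (λ pq → q , refl , pq) (λ { (_ , refl , pq) → pq }) (prime? q)
isPrimeℤ? -[1+ q ] = no λ { (_ , () , _) }

even⊎odd : ∀ m → ∃ λ i → m ≡ i ℕ.+ i ⊎ m ≡ suc (i ℕ.+ i)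
even⊎odd zero = 0 , inj₁ refl
even⊎odd (suc m) with even⊎odd m
... | i , inj₁ m≡i+i   = i , inj₂ (cong suc m≡i+i)
... | i , inj₂ m≡1+i+i = suc i , inj₁ (cong suc (trans m≡1+i+i (sym (ℕ.+-suc i i))))

even≢odd : ∀ a b → a ℕ.+ a ≢ suc (b ℕ.+ b)
even≢odd zero    b       ()
even≢odd (suc a) zero    eq rewrite ℕ.+-suc a a with eq
... | ()
even≢odd (suc a) (suc b) eq rewrite ℕ.+-suc a a | ℕ.+-suc b b =
  even≢odd a b (ℕ.suc-injective (ℕ.suc-injective eq))

m+m≡n+n⇒m≡n : ∀ {m n} → m ℕ.+ m ≡ n ℕ.+ n → m ≡ n
m+m≡n+n⇒m≡n {m} {n} eq = trans (ℕ.n≡⌊n+n/2⌋ m) (trans (cong ℕ.⌊_/2⌋ eq) (sym (ℕ.n≡⌊n+n/2⌋ n)))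

odd∣odd⇒ : ∀ {h k} → suc (h ℕ.+ h) ℕ.∣ suc (k ℕ.+ k) → ∃ λ i → k ≡ i ℕ.* suc (h ℕ.+ h) ℕ.+ h
odd∣odd⇒ {h} {k} (divides c 2k+1≡cp) with even⊎odd c
... | i , inj₁ refl = ⊥-elim (even≢odd (i ℕ.* p) k (sym (trans 2k+1≡cp (double-* i p))))
  where
  p = suc (h ℕ.+ h)
  double-* : ∀ i p → (i ℕ.+ i) ℕ.* p ≡ i ℕ.* p ℕ.+ i ℕ.* p
  double-* = ℕ-Solver.solve-∀
... | i , inj₂ refl = i , m+m≡n+n⇒m≡n (ℕ.suc-injective (trans 2k+1≡cp (odd-* i h)))
  where
  odd-* : ∀ i h → suc (i ℕ.+ i) ℕ.* suc (h ℕ.+ h) ≡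
                  suc ((i ℕ.* suc (h ℕ.+ h) ℕ.+ h) ℕ.+ (i ℕ.* suc (h ℕ.+ h) ℕ.+ h))
  odd-* = ℕ-Solver.solve-∀

odd-prime : ∀ {p} → Prime p → p ≢ 2 → ∃ λ h → p ≡ suc (suc h ℕ.+ suc h)
odd-prime {p} pp p≢2 with even⊎odd p
... | i , inj₁ refl with prime⇒irreducible pp (divides i (double i))
  where
  double : ∀ i → i ℕ.+ i ≡ i ℕ.* 2
  double = ℕ-Solver.solve-∀
...   | inj₁ ()
...   | inj₂ 2≡p = ⊥-elim (p≢2 (sym 2≡p))
odd-prime pp p≢2 | zero  , inj₂ refl = ⊥-elim (¬prime[1] pp)
odd-prime pp p≢2 | suc h , inj₂ refl = h , refl

half-odd : ∀ h → (suc (h ℕ.+ h) ∸ 1) / 2 ≡ h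
half-odd h = trans (cong (_/ 2) (double h)) (m*n/n≡m h 2)
  where
  double : ∀ h → h ℕ.+ h ≡ h ℕ.* 2
  double = ℕ-Solver.solve-∀

prime∤⇒coprime : ∀ {p m} → Prime p → ¬ p ℕ.∣ m → ℕ.Coprime p m
prime∤⇒coprime pp p∤m (d∣p , d∣m) with prime⇒irreducible pp d∣p
... | inj₁ d≡1 = d≡1
... | inj₂ refl = ⊥-elim (p∤m d∣m)

coprime⇒c+um≡vn : ∀ {m n} → ℕ.Coprime m (suc n) →
                  ∀ c → ∃₂ λ u v → c ℕ.+ u ℕ.* m ≡ v ℕ.* suc n
coprime⇒c+um≡vn {m} {n} cop c with coprime-Bézout cop
... | Bézout.-+ x y 1+xm≡yn = c ℕ.* x , c ℕ.* y , (begin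
  c ℕ.+ c ℕ.* x ℕ.* m      ≡⟨ factor c x m ⟩
  c ℕ.* (1 ℕ.+ x ℕ.* m)    ≡⟨ cong (c ℕ.*_) 1+xm≡yn ⟩
  c ℕ.* (y ℕ.* suc n)      ≡⟨ ℕ.*-assoc c y (suc n) ⟨
  c ℕ.* y ℕ.* suc n        ∎)
  where
  open ≡-Reasoning
  factor : ∀ c x m → c ℕ.+ c ℕ.* x ℕ.* m ≡ c ℕ.* (1 ℕ.+ x ℕ.* m)
  factor = ℕ-Solver.solve-∀
... | Bézout.+- x y 1+yn≡xm = c ℕ.* n ℕ.* x , c ℕ.+ c ℕ.* n ℕ.* y , (begin
  c ℕ.+ c ℕ.* n ℕ.* x ℕ.* m          ≡⟨ cong (c ℕ.+_) (ℕ.*-assoc (c ℕ.* n) x m) ⟩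
  c ℕ.+ c ℕ.* n ℕ.* (x ℕ.* m)        ≡⟨ cong (λ t → c ℕ.+ c ℕ.* n ℕ.* t) 1+yn≡xm ⟨
  c ℕ.+ c ℕ.* n ℕ.* (1 ℕ.+ y ℕ.* suc n) ≡⟨ factor c n y ⟩
  (c ℕ.+ c ℕ.* n ℕ.* y) ℕ.* suc n    ∎)
  where
  open ≡-Reasoning
  factor : ∀ c n y → c ℕ.+ c ℕ.* n ℕ.* (1 ℕ.+ y ℕ.* suc n) ≡ (c ℕ.+ c ℕ.* n ℕ.* y) ℕ.* suc n
  factor = ℕ-Solver.solve-∀

module _ (j : ℤ) {d : ℤ} where

  ∣s-+odd : ∀ {x y} → d Signed.∣ s x j → d Signed.∣ s y j →
            d Signed.∣ s (x ℕ.+ suc (y ℕ.+ y)) j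
  ∣s-+odd {x} {y} d∣sx d∣sy =
    subst (d Signed.∣_) (sym (s-+-odd j x y)) (Signed.∣m∣n⇒∣m+n d∣sx (Signed.∣m⇒∣m*n _ d∣sy))

  ∣s-+odd⁻¹ : ∀ {x y} → d Signed.∣ s (x ℕ.+ suc (y ℕ.+ y)) j → d Signed.∣ s y j →
              d Signed.∣ s x j
  ∣s-+odd⁻¹ {x} {y} d∣sx+m d∣sy =
    Signed.∣m+n∣n⇒∣m (subst (d Signed.∣_) (s-+-odd j x y) d∣sx+m) (Signed.∣m⇒∣m*n _ d∣sy)

  ∣s-+multiple : ∀ {x y} → d Signed.∣ s y j → ∀ u →
                 d Signed.∣ s x j → d Signed.∣ s (x ℕ.+ u ℕ.* suc (y ℕ.+ y)) j
  ∣s-+multiple {x} d∣sy zero    d∣sx = subst (λ i → d Signed.∣ s i j) (sym (ℕ.+-identityʳ x)) d∣sx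
  ∣s-+multiple {x} {y} d∣sy (suc u) d∣sx =
    subst (λ i → d Signed.∣ s i j) (ℕ.+-assoc x m (u ℕ.* m))
      (∣s-+multiple {x ℕ.+ m} {y} d∣sy u (∣s-+odd {x} {y} d∣sx d∣sy))
    where m = suc (y ℕ.+ y)

  ∣s-+multiple⁻¹ : ∀ {x y} → d Signed.∣ s y j → ∀ u →
                   d Signed.∣ s (x ℕ.+ u ℕ.* suc (y ℕ.+ y)) j → d Signed.∣ s x j
  ∣s-+multiple⁻¹ {x} d∣sy zero d∣sx+um = subst (λ i → d Signed.∣ s i j) (ℕ.+-identityʳ x) d∣sx+um
  ∣s-+multiple⁻¹ {x} {y} d∣sy (suc u) d∣sx+um =
    ∣s-+odd⁻¹ {x} {y} (∣s-+multiple⁻¹ {x ℕ.+ m} {y} d∣sy u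
      (subst (λ i → d Signed.∣ s i j) (sym (ℕ.+-assoc x m (u ℕ.* m))) d∣sx+um)) d∣sy
    where m = suc (y ℕ.+ y)

  -- Walk up from index k by u steps of 2k+1 to index v(2h+1), then down by v steps of 2h+1 to 0.
  s-common-divisor : ∀ {k h} → ℕ.Coprime (suc (k ℕ.+ k)) (suc (h ℕ.+ h)) →
                     d Signed.∣ s k j → d Signed.∣ s h j → d Signed.∣ + 1
  s-common-divisor {k} {h} cop d∣sk d∣sh with coprime⇒c+um≡vn cop k
  ... | u , v , k+um≡vn =
    ∣s-+multiple⁻¹ {0} {h} d∣sh v
      (subst (λ i → d Signed.∣ s i j) k+um≡vn (∣s-+multiple {k} {k} d∣sk u d∣sk))

s-coprime : ∀ j {k h} → ℕ.Coprime (suc (k ℕ.+ k)) (suc (h ℕ.+ h)) → Coprime (s k j) (s h j)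
s-coprime j {k} {h} cop {i} (i∣sk , i∣sh) =
  ℕ.∣1⇒≡1 (∣⇒∣ᵤ (s-common-divisor j {+ i} {k} {h} cop (∣ᵤ⇒∣ {+ i} i∣sk) (∣ᵤ⇒∣ {+ i} i∣sh)))

no-prime-s-𝒯₂ : ∀ {j} → + 3 ≤ j → ∀ k → ¬ IsPrimeℤ (s k (𝒯 2 j))
no-prime-s-𝒯₂     3≤j zero    = ¬IsPrimeℤ-1
no-prime-s-𝒯₂ {j} 3≤j (suc k) rewrite s-𝒯₂ j (suc k) =
  ¬IsPrimeℤ-* (s-suc-≥2 (≤-trans 2≤3 3≤j) k) (r-suc-≥2 3≤j k)

module _ {j : ℤ} (3≤j : + 3 ≤ j) {h : ℕ} (p-prime : Prime (suc (suc h ℕ.+ suc h))) where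

  private
    H = suc h
    p = suc (H ℕ.+ H)
    n = 𝒯 p j
    2≤j : + 2 ≤ j
    2≤j = ≤-trans 2≤3 3≤j
    2≤n : + 2 ≤ n
    2≤n = 𝒯-≥2 2≤j p

  prime-index-multiple : ∀ {k} → p ℕ.∣ suc (k ℕ.+ k) → IsPrimeℤ (s k n) → k ≡ H
  prime-index-multiple {k} p∣2k+1 prime with odd∣odd⇒ {H} {k} p∣2k+1
  ... | zero  , refl = refl
  ... | suc i , refl = ⊥-elim (¬IsPrimeℤ-* (s-suc-≥2 2≤n h) (s-suc-≥2 (𝒯-≥2 2≤n p) i)
                                           (subst IsPrimeℤ (s-odd-factor n H (suc i)) prime))

  prime-index-coprime : ∀ {k} → ¬ p ℕ.∣ suc (suc k ℕ.+ suc k) → ¬ IsPrimeℤ (s (suc k) n)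
  prime-index-coprime {k} p∤m =
    ¬IsPrimeℤ-proper-divisor (s-suc-≥2 2≤j k)
                             (s-<-argument 2≤j (𝒯-suc-suc-> 3≤j (h ℕ.+ suc h)) k) G∣sKn
    where
    open ≡-Reasoning
    K = suc k
    m = suc (K ℕ.+ K)
    G = s K j
    A = s H j
    B = s H (𝒯 m j)
    two-factorisations : A * s K n ≡ G * B
    two-factorisations = begin
      A * s K n             ≡⟨ s-odd-factor j H K ⟨
      s (K ℕ.* p ℕ.+ H) j   ≡⟨ cong (λ i → s i j) (index K H) ⟩
      s (H ℕ.* m ℕ.+ K) j   ≡⟨ s-odd-factor j K H ⟩
      G * B                 ∎
      where
      index : ∀ K H → K ℕ.* suc (H ℕ.+ H) ℕ.+ H ≡ H ℕ.* suc (K ℕ.+ K) ℕ.+ K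
      index = ℕ-Solver.solve-∀
    G∣sKn : G Unsigned.∣ s K n
    G∣sKn = coprime-divisor G A (s K n) (s-coprime j {K} {H} (ℕ.sym (prime∤⇒coprime p-prime p∤m)))
              (∣⇒∣ᵤ (Signed.divides B (trans two-factorisations (*-comm G B))))

  prime-index-unique : ∀ k → IsPrimeℤ (s k n) → k ≡ H
  prime-index-unique zero    prime = ⊥-elim (¬IsPrimeℤ-1 prime)
  prime-index-unique (suc k) prime with p ∣? suc (suc k ℕ.+ suc k)
  ... | yes p∣m = prime-index-multiple p∣m prime
  ... | no  p∤m = ⊥-elim (prime-index-coprime p∤m prime)

HasA-of-unique-prime-index : ∀ {n H} → 1 ℕ.≤ H → (∀ k → IsPrimeℤ (s k n) → k ≡ H) →
  (¬ IsPrimeℤ (s H n) × HasA n -[1+ 0 ])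
  ⊎ (IsPrimeℤ (s H n) × (∀ k → IsPrimeℤ (s k n) → k ≡ H) × HasA n (+ H))
HasA-of-unique-prime-index {n} {H} 1≤H unique with isPrimeℤ? (s H n)
... | yes prime = inj₂ (prime , unique ,
        inj₂ (H , 1≤H , refl , prime , λ k _ k<H prime-k → ℕ.<⇒≢ k<H (unique k prime-k)))
... | no ¬prime = inj₁ (¬prime ,
        inj₁ (refl , λ k prime-k → ¬prime (subst (λ i → IsPrimeℤ (s i n)) (unique k prime-k) prime-k)))

HasA-𝒯-odd-prime : ∀ (n j : ℤ) (p : ℕ) → + 3 ≤ j → Prime p → ¬ (p ≡ 2) → n ≡ 𝒯 p j →
  ((¬ IsPrimeℤ (s ((p ∸ 1) / 2) n)) × HasA n -[1+ 0 ])
  ⊎ (IsPrimeℤ (s ((p ∸ 1) / 2) n)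
     × (∀ (k : ℕ) → IsPrimeℤ (s k n) → k ≡ (p ∸ 1) / 2)
     × HasA n (+ ((p ∸ 1) / 2)))
HasA-𝒯-odd-prime n j p 3≤j p-prime p≢2 refl with odd-prime p-prime p≢2
... | h , refl rewrite half-odd (suc h) =
  HasA-of-unique-prime-index (s≤s z≤n) (prime-index-unique 3≤j p-prime)

theorem38 :
    (∀ (n j : ℤ) → + 3 ≤ j → n ≡ 𝒯 2 j → HasA n -[1+ 0 ])
    × (∀ (n j : ℤ) (p : ℕ) → + 3 ≤ j → Prime p → ¬ (p ≡ 2) → n ≡ 𝒯 p j →
         ((¬ IsPrimeℤ (s ((p ∸ 1) / 2) n)) × HasA n -[1+ 0 ])
         ⊎ (IsPrimeℤ (s ((p ∸ 1) / 2) n)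
            × (∀ (k : ℕ) → IsPrimeℤ (s k n) → k ≡ (p ∸ 1) / 2)
            × HasA n (+ ((p ∸ 1) / 2))))
theorem38 = (λ { n j 3≤j refl → inj₁ (refl , no-prime-s-𝒯₂ 3≤j) }) , HasA-𝒯-odd-prime
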